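{- Let $r\ge3$ and $1<s\le r$ be integers and let $a_1,\dots,a_r\in\Omega$ be defined recursively by $a_1=(a_r,\mathrm{id})\sigma$, $a_i=(\mathrm{id},a_{i-1})$ for $2\le i\le s-1$, $a_s=(\mathrm{id},a_{s-1})\sigma$, $a_i=(a_{i-1},\mathrm{id})$ for $s+1\le i\le r$. Then for all $n\ge1$ and all $i=1,\dots,r$, $$\mathrm{sgn}_n(a_i)=\begin{cases}-1&\text{if } n\equiv i \text{ or } n\equiv i+1-s\pmod r,\\ 1&\text{otherwise.}\end{cases}$$
   Context: $T$ is the regular rooted binary tree whose vertices are finite words over $\{0,1\}$ (level $n$ = words of length $n$, $2^n$ vertices); $\Omega=\mathrm{Aut}(T)$; automorphisms act on the right and $\gamma\gamma'$ means first $\gamma$ then $\gamma'$. Every $\gamma\in\Omega$ is written uniquely as $(\gamma_0,\gamma_1)\tau$ with $\tau\in\{\mathrm{id},\sigma\}$, meaning $(xv)\gamma=(x)\tau\,(v)\gamma_x$ for a letter $x$ and word $v$; $\sigma=(\mathrm{id},\mathrm{id})\sigma$ swaps the first letter. Multiplication: $(\gamma_0,\gamma_1)\tau\cdot(\gamma_0',\gamma_1')\tau'=(\gamma_0\gamma'_{(0)\tau},\gamma_1\gamma'_{(1)\tau})\tau\tau'$. For $\gamma\in\Omega$, $\mathrm{sgn}_n(\gamma)\in\{\pm1\}$ is the sign of the permutation induced by $\gamma$ on level $n$. -}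

module Defs where

open import Data.Bool using (Bool; true; false; _xor_; if_then_else_)
open import Data.Nat using (ℕ; zero; suc; _+_)
open import Data.List using (List; []; _∷_; map; _++_; concatMap; length)
open import Data.Vec using (Vec; []; _∷_)
open import Data.Integer using (ℤ; -1ℤ; 1ℤ)
open import Data.Nat using (_%_; _≡ᵇ_)
open import Data.Product using (_×_; _,_; proj₁; proj₂)
open import Data.Bool using (_∧_)
open import Relation.Binary.PropositionalEquality using (_≡_)

-- Vertices of the binary tree T: finite words over {0,1}, with 0 = false, 1 = true.
Word : Set
Word = List Bool

-- An automorphism γ ∈ Ω = Aut(T) is represented by its portrait: the function
-- assigning to each vertex v the root permutation τ of the section γ_v
-- (true = σ, false = id).  This is a bijective encoding of Ω.
Aut : Set
Aut = Word → Bool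

_≈_ : Aut → Aut → Set
γ ≈ δ = ∀ w → γ w ≡ δ w

idA : Aut
idA _ = false

-- The automorphism (γ₀ , γ₁) τ  (τ = true means σ).
node : Aut → Aut → Bool → Aut
node γ₀ γ₁ τ []            = τ
node γ₀ γ₁ τ (false ∷ w)   = γ₀ w
node γ₀ γ₁ τ (true  ∷ w)   = γ₁ w

section : Aut → Bool → Aut
section γ x w = γ (x ∷ w)

act : ∀ {n} → Aut → Vec Bool n → Vec Bool n
act γ []      = []
act γ (x ∷ v) = (x xor γ []) ∷ act (section γ x) v

level : (n : ℕ) → List (Vec Bool n)
level zero    = [] ∷ []
level (suc n) = map (false ∷_) (level n) ++ map (true ∷_) (level n)

lt : ∀ {n} → Vec Bool n → Vec Bool n → Bool
lt []          []          = false
lt (false ∷ u) (false ∷ v) = lt u v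
lt (true  ∷ u) (true  ∷ v) = lt u v
lt (false ∷ u) (true  ∷ v) = true
lt (true  ∷ u) (false ∷ v) = false

inversions : (n : ℕ) → Aut → ℕ
inversions n γ = length (filter? (level n ×ˡ level n))
  where
  isInv : Vec Bool n × Vec Bool n → Bool
  isInv (u , v) = lt u v ∧ lt (act γ v) (act γ u)
  _×ˡ_ : List (Vec Bool n) → List (Vec Bool n) → List (Vec Bool n × Vec Bool n)
  xs ×ˡ ys = concatMap (λ u → map (λ v → (u , v)) ys) xs
  filter? : List (Vec Bool n × Vec Bool n) → List (Vec Bool n × Vec Bool n)
  filter? []       = []
  filter? (p ∷ ps) = if isInv p then p ∷ filter? ps else filter? ps

sgn : ℕ → Aut → ℤ
sgn n γ = if (inversions n γ % 2) ≡ᵇ 0 then 1ℤ else -1ℤ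

module Submission where

-- Write parity n γ for the parity of the number of inversions of γ on level n.
-- The inversions of γ = (γ₀, γ₁)τ on level n + 1 are those of γ₀, those of γ₁ and,
-- when τ = σ, all 2ⁿ · 2ⁿ pairs across the root.  Hence parity 1 γ records τ and,
-- for n ≥ 1, parity (n + 1) γ = parity n γ₀ + parity n γ₁ (mod 2).  Every a_i has one
-- trivial section, so for n ≥ 1 parity (n + 1) a_i = parity n a_{i-1} with indices read
-- cyclically (a₀ = a_r), while parity 1 a_i = 1 exactly for i ∈ {1, s}.  Thus
-- parity n a_i = 1 iff i - (n - 1) ≡ 1 or s (mod r), which is the stated congruence.

open import Algebra.Properties.CommutativeSemigroup using (interchange)
open import Data.Bool using (Bool; true; false; _∧_; _xor_; if_then_else_)
open import Data.Integer using (ℤ; +_; _-_; -1ℤ; 1ℤ)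
import Data.Integer as ℤ
open import Data.Integer.Divisibility using (_∣_)
import Data.Integer.Divisibility.Signed as Signed
open import Data.Integer.Properties
  using (m-n≡m⊖n; ∣m⊝n∣≤m⊔n; ∣i∣≡0⇒i≡0; i-j≡0⇒i≡j; +-injective; +-inverseʳ)
import Data.Integer.Tactic.RingSolver as ℤ-Solver
open import Data.List using (List; []; _∷_; _++_; map; concatMap; length)
open import Data.List.Properties using (length-++; length-map)
open import Data.Nat using (ℕ; zero; suc; _+_; _*_; _^_; _∸_; _%_; _≡ᵇ_; _≤_; _<_; z≤n; s≤s)
open import Data.Nat.DivMod using (m%n<n; [m+kn]%n≡m%n)
open import Data.Nat.Divisibility using (>⇒∤) renaming (_∣_ to _∣ℕ_; _∣0 to _∣ℕ0)
open import Data.Nat.Properties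
  using (+-assoc; +-comm; +-identityʳ; +-commutativeSemigroup;
         ≤-refl; ≤-trans; ≤-<-trans; ⊔-lub; n≤1+n; <⇒≤pred; <-cmp)
import Data.Nat.Tactic.RingSolver as ℕ-Solver
open import Data.Product using (_×_; _,_; ∃-syntax; uncurry)
open import Data.Sum using (_⊎_; inj₁; inj₂)
open import Data.Sum.Function.Propositional using (_⊎-⇔_)
open import Data.Vec using (Vec; []; _∷_)
open import Defs
open import Function.Bundles using (_⇔_; mk⇔; module Equivalence)
open import Function.Properties.Equivalence using ()
  renaming (refl to ⇔-refl; sym to ⇔-sym; trans to ⇔-trans)
open import Relation.Binary.Definitions using (tri<; tri≈; tri>)
open import Relation.Binary.PropositionalEquality
  using (_≡_; refl; sym; trans; cong; cong₂; subst; module ≡-Reasoning)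
open import Relation.Nullary using (¬_; contradiction)

private
  variable
    A B C D : Set

subst-⇔ : ∀ (P : A → Set) {x y} → x ≡ y → P x ⇔ P y
subst-⇔ P refl = ⇔-refl

count : (A → Bool) → List A → ℕ
count p []       = 0
count p (x ∷ xs) = if p x then suc (count p xs) else count p xs

count-++ : ∀ (p : A → Bool) xs ys → count p (xs ++ ys) ≡ count p xs + count p ys
count-++ p []       ys = refl
count-++ p (x ∷ xs) ys with p x
... | true  = cong suc (count-++ p xs ys)
... | false = count-++ p xs ys

count-map : ∀ (p : B → Bool) (f : A → B) xs → count p (map f xs) ≡ count (λ x → p (f x)) xs
count-map p f []       = refl
count-map p f (x ∷ xs) = cong (λ c → if p (f x) then suc c else c) (count-map p f xs)

count-cong : ∀ {p q : A → Bool} → (∀ x → p x ≡ q x) → ∀ xs → count p xs ≡ count q xs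
count-cong e []       = refl
count-cong {q = q} e (x ∷ xs) rewrite e x = cong (λ c → if q x then suc c else c) (count-cong e xs)

count-const : ∀ b (xs : List A) → count (λ _ → b) xs ≡ (if b then length xs else 0)
count-const false []       = refl
count-const true  []       = refl
count-const false (x ∷ xs) = count-const false xs
count-const true  (x ∷ xs) = cong suc (count-const true xs)

countPairs : (A → B → Bool) → List A → List B → ℕ
countPairs p []       ys = 0
countPairs p (x ∷ xs) ys = count (p x) ys + countPairs p xs ys

pairs : List A → List B → List (A × B)
pairs xs ys = concatMap (λ x → map (x ,_) ys) xs

count-pairs : ∀ (p : A → B → Bool) xs ys → count (uncurry p) (pairs xs ys) ≡ countPairs p xs ys
count-pairs p []       ys = refl
count-pairs p (x ∷ xs) ys = begin
  count (uncurry p) (map (x ,_) ys ++ pairs xs ys)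
    ≡⟨ count-++ (uncurry p) (map (x ,_) ys) (pairs xs ys) ⟩
  count (uncurry p) (map (x ,_) ys) + count (uncurry p) (pairs xs ys)
    ≡⟨ cong₂ _+_ (count-map (uncurry p) (x ,_) ys) (count-pairs p xs ys) ⟩
  count (p x) ys + countPairs p xs ys
    ∎
  where open ≡-Reasoning

countPairs-++ˡ : ∀ (p : A → B → Bool) xs xs' ys →
  countPairs p (xs ++ xs') ys ≡ countPairs p xs ys + countPairs p xs' ys
countPairs-++ˡ p []       xs' ys = refl
countPairs-++ˡ p (x ∷ xs) xs' ys = trans
  (cong (λ c → count (p x) ys + c) (countPairs-++ˡ p xs xs' ys))
  (sym (+-assoc (count (p x) ys) (countPairs p xs ys) (countPairs p xs' ys)))

countPairs-++ʳ : ∀ (p : A → B → Bool) xs ys ys' →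
  countPairs p xs (ys ++ ys') ≡ countPairs p xs ys + countPairs p xs ys'
countPairs-++ʳ p []       ys ys' = refl
countPairs-++ʳ p (x ∷ xs) ys ys' = trans
  (cong₂ _+_ (count-++ (p x) ys ys') (countPairs-++ʳ p xs ys ys'))
  (interchange +-commutativeSemigroup
    (count (p x) ys) (count (p x) ys') (countPairs p xs ys) (countPairs p xs ys'))

countPairs-++ : ∀ (p : A → B → Bool) xs xs' ys ys' →
  countPairs p (xs ++ xs') (ys ++ ys')
    ≡ (countPairs p xs ys + countPairs p xs ys') + (countPairs p xs' ys + countPairs p xs' ys')
countPairs-++ p xs xs' ys ys' = trans (countPairs-++ˡ p xs xs' (ys ++ ys'))
  (cong₂ _+_ (countPairs-++ʳ p xs ys ys') (countPairs-++ʳ p xs' ys ys'))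

countPairs-map : ∀ (p : C → D → Bool) (f : A → C) (g : B → D) xs ys →
  countPairs p (map f xs) (map g ys) ≡ countPairs (λ x y → p (f x) (g y)) xs ys
countPairs-map p f g []       ys = refl
countPairs-map p f g (x ∷ xs) ys = cong₂ _+_ (count-map (p (f x)) g ys) (countPairs-map p f g xs ys)

countPairs-cong : ∀ {p q : A → B → Bool} → (∀ x y → p x y ≡ q x y) →
  ∀ xs ys → countPairs p xs ys ≡ countPairs q xs ys
countPairs-cong e []       ys = refl
countPairs-cong e (x ∷ xs) ys = cong₂ _+_ (count-cong (e x) ys) (countPairs-cong e xs ys)

countPairs-const : ∀ b (xs : List A) (ys : List B) →
  countPairs (λ _ _ → b) xs ys ≡ (if b then length xs * length ys else 0)
countPairs-const false []       ys = refl
countPairs-const true  []       ys = refl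
countPairs-const false (x ∷ xs) ys = cong₂ _+_ (count-const false ys) (countPairs-const false xs ys)
countPairs-const true  (x ∷ xs) ys = cong₂ _+_ (count-const true ys) (countPairs-const true xs ys)

inverted : ∀ {n} → Aut → Vec Bool n → Vec Bool n → Bool
inverted γ u v = lt u v ∧ lt (act γ v) (act γ u)

-- `inversions` filters with a function local to its where block, which cannot be
-- named here; the statement of `length-filter` is therefore left as a meta, solved
-- by its use in `inversions≡count`.
mutual
  LengthOfFilter : (n : ℕ) → Aut → List (Vec Bool n × Vec Bool n) → Set
  LengthOfFilter = _

  inversions≡count : ∀ n γ →
    inversions n γ ≡ count (uncurry (inverted γ)) (pairs (level n) (level n))
  inversions≡count n γ with pairs (level n) (level n)
  ... | ps = length-filter n γ ps

  length-filter : ∀ n γ ps → LengthOfFilter n γ ps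
  length-filter n γ []       = refl
  length-filter n γ (p ∷ ps) with uncurry (inverted γ) p
  ... | true  = cong suc (length-filter n γ ps)
  ... | false = length-filter n γ ps

inversions≡countPairs : ∀ n γ → inversions n γ ≡ countPairs (inverted γ) (level n) (level n)
inversions≡countPairs n γ =
  trans (inversions≡count n γ) (count-pairs (inverted γ) (level n) (level n))

act-cong : ∀ {γ δ} → γ ≈ δ → ∀ {n} (v : Vec Bool n) → act γ v ≡ act δ v
act-cong e []      = refl
act-cong e (x ∷ v) = cong₂ _∷_ (cong (x xor_) (e [])) (act-cong (λ w → e (x ∷ w)) v)

inversions-cong : ∀ n {γ δ} → γ ≈ δ → inversions n γ ≡ inversions n δ
inversions-cong n {γ} {δ} e = begin
  inversions n γ                               ≡⟨ inversions≡countPairs n γ ⟩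
  countPairs (inverted γ) (level n) (level n)  ≡⟨ countPairs-cong same-images (level n) (level n) ⟩
  countPairs (inverted δ) (level n) (level n)  ≡⟨ inversions≡countPairs n δ ⟨
  inversions n δ                               ∎
  where
  open ≡-Reasoning
  same-images : ∀ u v → inverted γ u v ≡ inverted δ u v
  same-images u v = cong₂ (λ x y → lt u v ∧ lt x y) (act-cong e v) (act-cong e u)

length-level : ∀ n → length (level n) ≡ 2 ^ n
length-level zero    = refl
length-level (suc n) = begin
  length (map (false ∷_) L ++ map (true ∷_) L)          ≡⟨ length-++ (map (false ∷_) L) ⟩
  length (map (false ∷_) L) + length (map (true ∷_) L)  ≡⟨ cong₂ _+_ (length-map _ L) (length-map _ L) ⟩
  length L + length L                                   ≡⟨ cong (λ k → k + k) (length-level n) ⟩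
  2 ^ n + 2 ^ n                                         ≡⟨ cong (λ k → 2 ^ n + k) (+-identityʳ (2 ^ n)) ⟨
  2 ^ suc n                                             ∎
  where
  open ≡-Reasoning
  L : List (Vec Bool n)
  L = level n

lt-∷ : ∀ {n} b (u v : Vec Bool n) → lt (b ∷ u) (b ∷ v) ≡ lt u v
lt-∷ false u v = refl
lt-∷ true  u v = refl

inverted-∷ : ∀ γ x {n} (u v : Vec Bool n) → inverted γ (x ∷ u) (x ∷ v) ≡ inverted (section γ x) u v
inverted-∷ γ x u v = cong₂ _∧_ (lt-∷ x u v) (lt-∷ (x xor γ []) _ _)

inverted-across : ∀ γ {n} (u v : Vec Bool n) → inverted γ (false ∷ u) (true ∷ v) ≡ γ []
inverted-across γ u v with γ []
... | false = refl
... | true  = refl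

inversions-suc : ∀ n γ → inversions (suc n) γ
  ≡ inversions n (section γ false) + inversions n (section γ true)
    + (if γ [] then 2 ^ n * 2 ^ n else 0)
inversions-suc n γ = begin
  inversions (suc n) γ
    ≡⟨ inversions≡countPairs (suc n) γ ⟩
  countPairs (inverted γ) (L₀ ++ L₁) (L₀ ++ L₁)
    ≡⟨ countPairs-++ (inverted γ) L₀ L₁ L₀ L₁ ⟩
  (block false false + block false true) + (block true false + block true true)
    ≡⟨ cong₂ _+_ (cong₂ _+_ (diagonal false) across) (cong₂ _+_ backwards (diagonal true)) ⟩
  (inversions n γ₀ + cross) + (0 + inversions n γ₁)
    ≡⟨ rearrange (inversions n γ₀) (inversions n γ₁) cross ⟩
  inversions n γ₀ + inversions n γ₁ + cross
    ∎
  where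
  open ≡-Reasoning
  L : List (Vec Bool n)
  L = level n
  L₀ L₁ : List (Vec Bool (suc n))
  L₀ = map (false ∷_) L
  L₁ = map (true ∷_) L
  γ₀ γ₁ : Aut
  γ₀ = section γ false
  γ₁ = section γ true
  cross : ℕ
  cross = if γ [] then 2 ^ n * 2 ^ n else 0

  rearrange : ∀ a b c → (a + c) + (0 + b) ≡ a + b + c
  rearrange = ℕ-Solver.solve-∀

  block : Bool → Bool → ℕ
  block x y = countPairs (inverted γ) (map (x ∷_) L) (map (y ∷_) L)

  block-map : ∀ x y → block x y ≡ countPairs (λ u v → inverted γ (x ∷ u) (y ∷ v)) L L
  block-map x y = countPairs-map (inverted γ) (x ∷_) (y ∷_) L L

  diagonal : ∀ x → block x x ≡ inversions n (section γ x)
  diagonal x = trans (block-map x x)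
    (trans (countPairs-cong (inverted-∷ γ x) L L) (sym (inversions≡countPairs n (section γ x))))

  across : block false true ≡ cross
  across = trans (block-map false true) (trans (countPairs-cong (inverted-across γ) L L)
    (trans (countPairs-const (γ []) L L) (cong (λ k → if γ [] then k * k else 0) (length-level n))))

  backwards : block true false ≡ 0
  backwards = trans (block-map true false) (countPairs-const false L L)

inversions-id : ∀ n → inversions n idA ≡ 0
inversions-id zero    = refl
inversions-id (suc n) =
  trans (inversions-suc n idA) (cong₂ (λ x y → x + y + 0) (inversions-id n) (inversions-id n))

parity : ℕ → Aut → ℕ
parity n γ = inversions n γ % 2

parity-1⇔root : ∀ γ → parity 1 γ ≡ 1 ⇔ γ [] ≡ true
parity-1⇔root γ = ⇔-trans (subst-⇔ (_≡ 1) (cong (_% 2) (inversions-suc 0 γ))) (root-odd (γ []))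
  where
  root-odd : ∀ b → (if b then 1 else 0) % 2 ≡ 1 ⇔ b ≡ true
  root-odd false = mk⇔ (λ ()) (λ ())
  root-odd true  = mk⇔ (λ _ → refl) (λ _ → refl)

parity-suc : ∀ n γ → parity (suc (suc n)) γ
  ≡ (inversions (suc n) (section γ false) + inversions (suc n) (section γ true)) % 2
parity-suc n γ = trans (cong (_% 2) (inversions-suc (suc n) γ)) (cross-even (γ []))
  where
  m : ℕ
  m = inversions (suc n) (section γ false) + inversions (suc n) (section γ true)

  double : ∀ x y → 2 * x * y ≡ x * y * 2
  double = ℕ-Solver.solve-∀

  cross-even : ∀ τ → (m + (if τ then 2 ^ suc n * 2 ^ suc n else 0)) % 2 ≡ m % 2
  cross-even false = cong (_% 2) (+-identityʳ m)
  cross-even true  = trans (cong (λ k → (m + k) % 2) (double (2 ^ n) (2 ^ suc n)))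
                           ([m+kn]%n≡m%n m (2 ^ n * 2 ^ suc n) 2)

SingleBranch : Aut → Aut → Set
SingleBranch γ δ = ∃[ τ ] (γ ≈ node δ idA τ ⊎ γ ≈ node idA δ τ)

parity-branch : ∀ {γ δ} → SingleBranch γ δ → ∀ n → parity (suc (suc n)) γ ≡ parity (suc n) δ
parity-branch {γ} {δ} (τ , inj₁ e) n = begin
  parity (suc (suc n)) γ               ≡⟨ cong (_% 2) (inversions-cong (suc (suc n)) e) ⟩
  parity (suc (suc n)) (node δ idA τ)  ≡⟨ parity-suc n (node δ idA τ) ⟩
  (I δ + I idA) % 2                    ≡⟨ cong (λ k → (I δ + k) % 2) (inversions-id (suc n)) ⟩
  (I δ + 0) % 2                        ≡⟨ cong (_% 2) (+-identityʳ (I δ)) ⟩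
  parity (suc n) δ                     ∎
  where
  open ≡-Reasoning
  I : Aut → ℕ
  I = inversions (suc n)
parity-branch {γ} {δ} (τ , inj₂ e) n = begin
  parity (suc (suc n)) γ               ≡⟨ cong (_% 2) (inversions-cong (suc (suc n)) e) ⟩
  parity (suc (suc n)) (node idA δ τ)  ≡⟨ parity-suc n (node idA δ τ) ⟩
  (I idA + I δ) % 2                    ≡⟨ cong (λ k → (k + I δ) % 2) (inversions-id (suc n)) ⟩
  parity (suc n) δ                     ∎
  where
  open ≡-Reasoning
  I : Aut → ℕ
  I = inversions (suc n)

sgn-odd : ∀ n γ → parity n γ ≡ 1 → sgn n γ ≡ -1ℤ
sgn-odd n γ odd = cong (λ k → if k ≡ᵇ 0 then 1ℤ else -1ℤ) odd

sgn-even : ∀ n γ → ¬ parity n γ ≡ 1 → sgn n γ ≡ 1ℤ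
sgn-even n γ ¬odd = cong (λ k → if k ≡ᵇ 0 then 1ℤ else -1ℤ) (bit≢1 (m%n<n (inversions n γ) 2) ¬odd)
  where
  bit≢1 : ∀ {k} → k < 2 → ¬ k ≡ 1 → k ≡ 0
  bit≢1 {zero}        _              _   = refl
  bit≢1 {suc zero}    _              k≢1 = contradiction refl k≢1
  bit≢1 {suc (suc _)} (s≤s (s≤s ())) _

Congruent : ℕ → ℕ → ℕ → ℕ → Set
Congruent r s n i = (+ r ∣ (+ n - + i)) ⊎ (+ r ∣ (+ n - (+ (i + 1) - + s)))

[1+x]-[1+y]≡x-y : ∀ x y → (1ℤ ℤ.+ x) - (1ℤ ℤ.+ y) ≡ x - y
[1+x]-[1+y]≡x-y = ℤ-Solver.solve-∀

∣x+r⇔∣x : ∀ r x → + r ∣ x ℤ.+ + r ⇔ + r ∣ x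
∣x+r⇔∣x r x = mk⇔
  (λ d → Signed.∣⇒∣ᵤ (Signed.∣m+n∣n⇒∣m {+ r} {x} (Signed.∣ᵤ⇒∣ {+ r} {x ℤ.+ + r} d) Signed.∣-refl))
  (λ d → Signed.∣⇒∣ᵤ (Signed.∣m∣n⇒∣m+n {+ r} {x} (Signed.∣ᵤ⇒∣ {+ r} {x} d) Signed.∣-refl))

∣m-n⇔m≡n : ∀ {r m n} → 1 ≤ m → m ≤ r → 1 ≤ n → n ≤ r → + r ∣ + m - + n ⇔ m ≡ n
∣m-n⇔m≡n {r} {suc m} {suc n} _ m<r _ n<r = mk⇔ to from
  where
  small : ∀ {k} → k < r → r ∣ℕ k → k ≡ 0
  small {zero}  _   _   = refl
  small {suc k} k<r r∣k = contradiction r∣k (>⇒∤ k<r)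

  to : + r ∣ + suc m - + suc n → suc m ≡ suc n
  to r∣ = cong suc (+-injective (i-j≡0⇒i≡j (+ m) (+ n) (∣i∣≡0⇒i≡0 (small bound r∣'))))
    where
    r∣' : r ∣ℕ ℤ.∣ + m - + n ∣
    r∣' = subst (λ z → r ∣ℕ ℤ.∣ z ∣) ([1+x]-[1+y]≡x-y (+ m) (+ n)) r∣
    bound : ℤ.∣ + m - + n ∣ < r
    bound = subst (_< r) (cong ℤ.∣_∣ (sym (m-n≡m⊖n m n)))
                  (≤-<-trans (∣m⊝n∣≤m⊔n m n) (⊔-lub m<r n<r))

  from : suc m ≡ suc n → + r ∣ + suc m - + suc n
  from refl = subst (+ r ∣_) (sym (+-inverseʳ (+ suc m))) (r ∣ℕ0)

Congruent-suc : ∀ r s n i → Congruent r s (suc n) (suc i) ⇔ Congruent r s n i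
Congruent-suc r s n i =
  subst-⇔ (+ r ∣_) ([1+x]-[1+y]≡x-y (+ n) (+ i))
    ⊎-⇔ subst-⇔ (+ r ∣_) (peel (+ n) (+ (i + 1)) (+ s))
  where
  peel : ∀ x y z → (1ℤ ℤ.+ x) - ((1ℤ ℤ.+ y) - z) ≡ x - (y - z)
  peel = ℤ-Solver.solve-∀

Congruent-wrap : ∀ r s n → Congruent r s (suc n) 1 ⇔ Congruent r s n r
Congruent-wrap r s n =
  ⇔-trans (subst-⇔ (+ r ∣_) (shift₁ (+ n) (+ r))) (∣x+r⇔∣x r (+ n - + r))
    ⊎-⇔ ⇔-trans (subst-⇔ (+ r ∣_) (shift₂ (+ n) (+ r) (+ s)))
                (∣x+r⇔∣x r (+ n - (+ (r + 1) - + s)))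
  where
  shift₁ : ∀ x y → (1ℤ ℤ.+ x) - 1ℤ ≡ (x - y) ℤ.+ y
  shift₁ = ℤ-Solver.solve-∀
  shift₂ : ∀ x y z → (1ℤ ℤ.+ x) - ((1ℤ ℤ.+ 1ℤ) - z) ≡ (x - ((y ℤ.+ 1ℤ) - z)) ℤ.+ y
  shift₂ = ℤ-Solver.solve-∀

Congruent-1 : ∀ {r s i} → 1 ≤ s → s ≤ r → 1 ≤ i → i ≤ r → Congruent r s 1 i ⇔ (1 ≡ i ⊎ s ≡ i)
Congruent-1 {r} {s} {i} 1≤s s≤r 1≤i i≤r =
  ∣m-n⇔m≡n ≤-refl (≤-trans 1≤i i≤r) 1≤i i≤r
    ⊎-⇔ ⇔-trans (subst-⇔ (+ r ∣_) (flip (+ i) (+ s))) (∣m-n⇔m≡n 1≤s s≤r 1≤i i≤r)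
  where
  flip : ∀ x y → 1ℤ - ((x ℤ.+ 1ℤ) - y) ≡ y - x
  flip = ℤ-Solver.solve-∀

module _ (r s : ℕ) (2≤s : 2 ≤ s) (s≤r : s ≤ r) (a : ℕ → Aut)
  (a₁ : a 1 ≈ node (a r) idA true)
  (a-low : ∀ i → 2 ≤ i → i ≤ s ∸ 1 → a i ≈ node idA (a (i ∸ 1)) false)
  (aₛ : a s ≈ node idA (a (s ∸ 1)) true)
  (a-high : ∀ i → s + 1 ≤ i → i ≤ r → a i ≈ node (a (i ∸ 1)) idA false)
  where

  private
    1≤s : 1 ≤ s
    1≤s = ≤-trans (n≤1+n 1) 2≤s

    <⇒+1≤ : ∀ {i} → s < i → s + 1 ≤ i
    <⇒+1≤ {i} = subst (_≤ i) (+-comm 1 s)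

  a-branch : ∀ k → 2 + k ≤ r → SingleBranch (a (2 + k)) (a (1 + k))
  a-branch k i≤r with <-cmp (2 + k) s
  ... | tri< i<s _ _ = false , inj₂ (a-low (2 + k) (s≤s (s≤s z≤n)) (<⇒≤pred i<s))
  ... | tri≈ _ i≡s _ = subst (λ j → SingleBranch (a j) (a (j ∸ 1))) (sym i≡s) (true , inj₂ aₛ)
  ... | tri> _ _ s<i = false , inj₁ (a-high (2 + k) (<⇒+1≤ s<i) i≤r)

  a-root⇔ : ∀ {i} → 1 ≤ i → i ≤ r → a i [] ≡ true ⇔ (1 ≡ i ⊎ s ≡ i)
  a-root⇔ {i} 1≤i i≤r = mk⇔ (to i 1≤i i≤r) from
    where
    from : 1 ≡ i ⊎ s ≡ i → a i [] ≡ true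
    from (inj₁ refl) = a₁ []
    from (inj₂ refl) = aₛ []

    to : ∀ i → 1 ≤ i → i ≤ r → a i [] ≡ true → 1 ≡ i ⊎ s ≡ i
    to (suc zero)    _ _   _    = inj₁ refl
    to (suc (suc k)) _ i≤r root with <-cmp (2 + k) s
    ... | tri< i<s _ _ =
      contradiction (trans (sym (a-low (2 + k) (s≤s (s≤s z≤n)) (<⇒≤pred i<s) [])) root) λ ()
    ... | tri≈ _ i≡s _ = inj₂ (sym i≡s)
    ... | tri> _ _ s<i =
      contradiction (trans (sym (a-high (2 + k) (<⇒+1≤ s<i) i≤r [])) root) λ ()

  parity⇔Congruent : ∀ m {i} → 1 ≤ i → i ≤ r → parity (suc m) (a i) ≡ 1 ⇔ Congruent r s (suc m) i
  parity⇔Congruent zero {i} 1≤i i≤r =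
    ⇔-trans (parity-1⇔root (a i)) (⇔-trans (a-root⇔ 1≤i i≤r) (⇔-sym (Congruent-1 1≤s s≤r 1≤i i≤r)))
  parity⇔Congruent (suc m) {suc zero} _ _ =
    ⇔-trans (subst-⇔ (_≡ 1) (parity-branch (true , inj₁ a₁) m))
      (⇔-trans (parity⇔Congruent m (≤-trans 1≤s s≤r) ≤-refl)
               (⇔-sym (Congruent-wrap r s (suc m))))
  parity⇔Congruent (suc m) {suc (suc k)} _ i≤r =
    ⇔-trans (subst-⇔ (_≡ 1) (parity-branch (a-branch k i≤r) m))
      (⇔-trans (parity⇔Congruent m (s≤s z≤n) (≤-trans (n≤1+n _) i≤r))
               (⇔-sym (Congruent-suc r s (suc m) (suc k))))

lemma5p2 : (r s : ℕ) → 3 ≤ r → 2 ≤ s → s ≤ r → (a : ℕ → Aut)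
    → a 1 ≈ node (a r) idA true
    → (∀ i → 2 ≤ i → i ≤ s ∸ 1 → a i ≈ node idA (a (i ∸ 1)) false)
    → a s ≈ node idA (a (s ∸ 1)) true
    → (∀ i → s + 1 ≤ i → i ≤ r → a i ≈ node (a (i ∸ 1)) idA false)
    → ∀ n i → 1 ≤ n → 1 ≤ i → i ≤ r
    → ((+ r ∣ (+ n - + i)) ⊎ (+ r ∣ (+ n - (+ (i + 1) - + s))) → sgn n (a i) ≡ -1ℤ)
      × (¬ ((+ r ∣ (+ n - + i)) ⊎ (+ r ∣ (+ n - (+ (i + 1) - + s)))) → sgn n (a i) ≡ 1ℤ)
lemma5p2 r s _ 2≤s s≤r a a₁ a-low aₛ a-high (suc m) i (s≤s z≤n) 1≤i i≤r =
  (λ c → sgn-odd (suc m) (a i) (Equivalence.from odd⇔ c)) ,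
  (λ ¬c → sgn-even (suc m) (a i) (λ odd → ¬c (Equivalence.to odd⇔ odd)))
  where
  odd⇔ : parity (suc m) (a i) ≡ 1 ⇔ Congruent r s (suc m) i
  odd⇔ = parity⇔Congruent r s 2≤s s≤r a a₁ a-low aₛ a-high m 1≤i i≤r
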